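{- Let $n$ be a positive integer with binary representation $n=a_0+a_1 2^1+a_2 2^2+\dots+a_s 2^s$ (each $a_i\in\{0,1\}$). Then $$\sum_{r=1}^{n}\frac{v_2(r)\,(3-v_2(r))}{2}=\sum_{i=1}^{s} i\,a_i.$$ In particular, for every nonnegative integer $m$, $$\sum_{r=1}^{2^m}\frac{v_2(r)\,(3-v_2(r))}{2}=m.$$
   Context: $v_2$ denotes the $2$-adic valuation. -}

module Defs where

open import Data.Nat as ℕ using (ℕ)
open import Data.Nat.DivMod using (_%_; _/_)
open import Data.Fin using (Fin; toℕ; zero; suc)
open import Data.Integer as ℤ using (ℤ; +_; _/ℕ_)

-- 2-adic valuation with a fuel argument; fuel r suffices for input r
-- since halving strictly decreases a positive number.
v₂-aux : ℕ → ℕ → ℕ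
v₂-aux ℕ.zero r = 0
v₂-aux (ℕ.suc f) ℕ.zero = 0
v₂-aux (ℕ.suc f) (ℕ.suc r) with ℕ.suc r % 2
... | ℕ.zero = ℕ.suc (v₂-aux f (ℕ.suc r / 2))
... | ℕ.suc _ = 0

-- v₂ r = largest k with 2^k ∣ r, for r ≥ 1 (convention v₂ 0 = 0; never used)
v₂ : ℕ → ℕ
v₂ r = v₂-aux r r

sumFrom1 : ℕ → (ℕ → ℤ) → ℤ
sumFrom1 ℕ.zero f = + 0
sumFrom1 (ℕ.suc n) f = sumFrom1 n f ℤ.+ f (ℕ.suc n)

sumFin : (k : ℕ) → (Fin k → ℕ) → ℕ
sumFin ℕ.zero f = 0
sumFin (ℕ.suc k) f = f zero ℕ.+ sumFin k (λ i → f (suc i))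

-- the summand v₂(r)(3 - v₂(r))/2, computed in ℤ (the product is always even)
term : ℕ → ℤ
term r = ((+ v₂ r) ℤ.* ((+ 3) ℤ.- (+ v₂ r))) /ℕ 2

module Submission where

-- Write F n = Σ_{r=1}^{n} v₂(r)(3 − v₂(r))/2 and V n = Σ_{r=1}^{n} v₂(r).
-- The summand depends only on v = v₂ r: it is the weight w v = v(3 − v)/2,
-- characterised by w 0 = 0 and w (v + 1) + v = w v + 1.  Both summands vanish
-- at odd r, and v₂ (2k) = 1 + v₂ k, so summing over the doubles 2k ≤ 2m gives
-- the doubling laws
--     F (2m) + V m = F m + m        and        V (2m) = V m + m,
-- while appending the odd number 2m + 1 changes neither sum.  Consequently, if
-- a₀ … a_s are binary digits of n, the pair of equations
--     F n = Σ i·aᵢ        and        V n + Σ aᵢ = n     (Legendre's formula)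
-- is preserved by the recursion n = a₀ + 2·n' on the digit vector.

open import Defs
open import Data.Nat as ℕ using (ℕ; zero; suc; _*_; _^_; _≤_; _>_; z≤n; s≤s)
import Data.Nat.Properties as ℕP
open import Data.Nat.DivMod using (_%_; _/_; m*n/n≡m; m*n%n≡0; [m+kn]%n≡m%n; m/n<m)
open import Data.Integer as ℤ using (ℤ; +_; -[1+_]; _/ℕ_)
import Data.Integer.Properties as ℤP
open import Data.Integer.Tactic.RingSolver using (solve-∀)
import Data.Nat.Tactic.RingSolver as ℕSolver
open import Algebra.Properties.AbelianGroup ℤP.+-0-abelianGroup using (∙-cancelʳ)
open import Algebra.Properties.CommutativeSemigroup ℕP.+-commutativeSemigroup
  using () renaming (interchange to ℕ+-interchange)
open import Algebra.Properties.CommutativeSemigroup ℤP.+-commutativeSemigroup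
  using () renaming (interchange to ℤ+-interchange)
open import Data.Fin using (Fin; toℕ)
import Data.Fin as Fin
open import Data.Product using (_×_; _,_)
open import Function using (_∘_)
open import Relation.Binary.PropositionalEquality
open ≡-Reasoning

v₂-aux-fuel : ∀ f g r → r ≤ f → r ≤ g → v₂-aux f r ≡ v₂-aux g r
v₂-aux-fuel zero    zero    zero    _ _ = refl
v₂-aux-fuel zero    (suc g) zero    _ _ = refl
v₂-aux-fuel (suc f) zero    zero    _ _ = refl
v₂-aux-fuel (suc f) (suc g) zero    _ _ = refl
v₂-aux-fuel (suc f) (suc g) (suc r) r≤f r≤g with suc r % 2
... | zero  = cong suc (v₂-aux-fuel f g (suc r / 2) (half≤ r≤f) (half≤ r≤g))
  where
  half≤ : ∀ {h} → suc r ≤ suc h → suc r / 2 ≤ h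
  half≤ r≤h = ℕP.≤-pred (ℕP.≤-trans (m/n<m (suc r) 2 (s≤s (s≤s z≤n))) r≤h)
... | suc _ = refl

v₂-odd : ∀ k → v₂ (suc (k * 2)) ≡ 0
v₂-odd k with suc (k * 2) % 2 | [m+kn]%n≡m%n 1 k 2
... | .1 | refl = refl

v₂-double : ∀ k → v₂ (suc k * 2) ≡ suc (v₂ (suc k))
v₂-double k with suc (suc (k * 2)) % 2 | m*n%n≡0 (suc k) 2
... | .0 | refl = cong suc (begin
  v₂-aux (suc (k * 2)) (suc (suc (k * 2)) / 2) ≡⟨ cong (v₂-aux (suc (k * 2))) (m*n/n≡m (suc k) 2) ⟩
  v₂-aux (suc (k * 2)) (suc k)                 ≡⟨ v₂-aux-fuel _ _ (suc k) (s≤s (ℕP.m≤m*n k 2)) ℕP.≤-refl ⟩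
  v₂ (suc k)                                   ∎)

-- w v = v(3 − v)/2, given by its recursion.
weight : ℕ → ℤ
weight zero    = + 0
weight (suc v) = weight v ℤ.+ + 1 ℤ.- + v

weight-closed : ∀ v → + v ℤ.* (+ 3 ℤ.- + v) ≡ weight v ℤ.* + 2
weight-closed zero    = refl
weight-closed (suc v) = begin
  (+ 1 ℤ.+ + v) ℤ.* (+ 3 ℤ.- (+ 1 ℤ.+ + v))  ≡⟨ expand (+ v) ⟩
  + v ℤ.* (+ 3 ℤ.- + v) ℤ.+ (+ 2 ℤ.- + 2 ℤ.* + v)
    ≡⟨ cong (ℤ._+ (+ 2 ℤ.- + 2 ℤ.* + v)) (weight-closed v) ⟩
  weight v ℤ.* + 2 ℤ.+ (+ 2 ℤ.- + 2 ℤ.* + v) ≡⟨ collect (weight v) (+ v) ⟩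
  (weight v ℤ.+ + 1 ℤ.- + v) ℤ.* + 2         ∎
  where
  expand : ∀ x → (+ 1 ℤ.+ x) ℤ.* (+ 3 ℤ.- (+ 1 ℤ.+ x)) ≡ x ℤ.* (+ 3 ℤ.- x) ℤ.+ (+ 2 ℤ.- + 2 ℤ.* x)
  expand = solve-∀
  collect : ∀ w x → w ℤ.* + 2 ℤ.+ (+ 2 ℤ.- + 2 ℤ.* x) ≡ (w ℤ.+ + 1 ℤ.- x) ℤ.* + 2
  collect = solve-∀

half-of-double : ∀ x → (x ℤ.* + 2) /ℕ 2 ≡ x
half-of-double (+ zero)  = refl
half-of-double (+ suc n) = cong +_ (m*n/n≡m (suc n) 2)
half-of-double -[1+ n ] with suc (suc (n * 2)) % 2 | m*n%n≡0 (suc n) 2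
... | .0 | refl = cong (λ q → ℤ.- (+ q)) (m*n/n≡m (suc n) 2)

term-weight : ∀ r → term r ≡ weight (v₂ r)
term-weight r = trans (cong (_/ℕ 2) (weight-closed (v₂ r))) (half-of-double (weight (v₂ r)))

term-odd : ∀ k → term (suc (k * 2)) ≡ + 0
term-odd k = trans (term-weight (suc (k * 2))) (cong weight (v₂-odd k))

term-double : ∀ k → term (suc k * 2) ℤ.+ + v₂ (suc k) ≡ term (suc k) ℤ.+ + 1
term-double k = begin
  term (suc k * 2) ℤ.+ + v               ≡⟨ cong (ℤ._+ + v) (term-weight (suc k * 2)) ⟩
  weight (v₂ (suc k * 2)) ℤ.+ + v        ≡⟨ cong (λ u → weight u ℤ.+ + v) (v₂-double k) ⟩
  weight v ℤ.+ + 1 ℤ.- + v ℤ.+ + v      ≡⟨ cancel (weight v) (+ v) ⟩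
  weight v ℤ.+ + 1                       ≡⟨ cong (ℤ._+ + 1) (term-weight (suc k)) ⟨
  term (suc k) ℤ.+ + 1                   ∎
  where
  v = v₂ (suc k)
  cancel : ∀ w x → w ℤ.+ + 1 ℤ.- x ℤ.+ x ≡ w ℤ.+ + 1
  cancel = solve-∀

sumFrom1-cong : ∀ n {f g : ℕ → ℤ} → (∀ r → f (suc r) ≡ g (suc r)) → sumFrom1 n f ≡ sumFrom1 n g
sumFrom1-cong zero    f≗g = refl
sumFrom1-cong (suc n) f≗g = cong₂ ℤ._+_ (sumFrom1-cong n f≗g) (f≗g n)

sumFrom1-+ : ∀ n (f g : ℕ → ℤ) → sumFrom1 n (λ r → f r ℤ.+ g r) ≡ sumFrom1 n f ℤ.+ sumFrom1 n g
sumFrom1-+ zero    f g = refl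
sumFrom1-+ (suc n) f g = begin
  sumFrom1 n (λ r → f r ℤ.+ g r) ℤ.+ (f (suc n) ℤ.+ g (suc n))
    ≡⟨ cong (ℤ._+ (f (suc n) ℤ.+ g (suc n))) (sumFrom1-+ n f g) ⟩
  sumFrom1 n f ℤ.+ sumFrom1 n g ℤ.+ (f (suc n) ℤ.+ g (suc n))
    ≡⟨ ℤ+-interchange (sumFrom1 n f) (sumFrom1 n g) (f (suc n)) (g (suc n)) ⟩
  sumFrom1 n f ℤ.+ f (suc n) ℤ.+ (sumFrom1 n g ℤ.+ g (suc n)) ∎

sumFrom1-one : ∀ n → sumFrom1 n (λ _ → + 1) ≡ + n
sumFrom1-one zero    = refl
sumFrom1-one (suc n) = trans (cong (ℤ._+ + 1) (sumFrom1-one n)) (cong +_ (ℕP.+-comm n 1))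

sumFrom1-double : ∀ m (f : ℕ → ℤ) → (∀ k → f (suc (k * 2)) ≡ + 0) →
                  sumFrom1 (m * 2) f ≡ sumFrom1 m (λ k → f (k * 2))
sumFrom1-double zero    f odd = refl
sumFrom1-double (suc m) f odd = cong (ℤ._+ f (suc m * 2)) (begin
  sumFrom1 (m * 2) f ℤ.+ f (suc (m * 2)) ≡⟨ cong (λ x → sumFrom1 (m * 2) f ℤ.+ x) (odd m) ⟩
  sumFrom1 (m * 2) f ℤ.+ + 0            ≡⟨ ℤP.+-identityʳ _ ⟩
  sumFrom1 (m * 2) f                     ≡⟨ sumFrom1-double m f odd ⟩
  sumFrom1 m (λ k → f (k * 2))           ∎)

sumFrom1-append-odd : ∀ b m (f : ℕ → ℤ) → b ≤ 1 → f (suc (m * 2)) ≡ + 0 →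
                      sumFrom1 (b ℕ.+ m * 2) f ≡ sumFrom1 (m * 2) f
sumFrom1-append-odd zero          m f _ _    = refl
sumFrom1-append-odd (suc zero)    m f _ odd  = trans (cong (λ x → sumFrom1 (m * 2) f ℤ.+ x) odd) (ℤP.+-identityʳ _)
sumFrom1-append-odd (suc (suc b)) m f (s≤s ()) _

termSum : ℕ → ℤ
termSum n = sumFrom1 n term

valSum : ℕ → ℤ
valSum n = sumFrom1 n (λ r → + v₂ r)

val-odd : ∀ k → + v₂ (suc (k * 2)) ≡ + 0
val-odd k = cong +_ (v₂-odd k)

-- Doubling law for V: the doubles contribute 1 + v₂ k each.
valSum-double : ∀ m → valSum (m * 2) ≡ valSum m ℤ.+ + m
valSum-double m = begin
  valSum (m * 2)                                ≡⟨ sumFrom1-double m (λ r → + v₂ r) val-odd ⟩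
  sumFrom1 m (λ k → + v₂ (k * 2))              ≡⟨ sumFrom1-cong m (λ k → cong +_ (v₂-double k)) ⟩
  sumFrom1 m (λ k → + 1 ℤ.+ + v₂ k)            ≡⟨ sumFrom1-+ m (λ _ → + 1) (λ k → + v₂ k) ⟩
  sumFrom1 m (λ _ → + 1) ℤ.+ valSum m          ≡⟨ cong (ℤ._+ valSum m) (sumFrom1-one m) ⟩
  + m ℤ.+ valSum m                              ≡⟨ ℤP.+-comm (+ m) (valSum m) ⟩
  valSum m ℤ.+ + m                              ∎

termSum-double : ∀ m → termSum (m * 2) ℤ.+ valSum m ≡ termSum m ℤ.+ + m
termSum-double m = begin
  termSum (m * 2) ℤ.+ valSum m
    ≡⟨ cong (ℤ._+ valSum m) (sumFrom1-double m term term-odd) ⟩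
  sumFrom1 m (λ k → term (k * 2)) ℤ.+ valSum m
    ≡⟨ sumFrom1-+ m (λ k → term (k * 2)) (λ k → + v₂ k) ⟨
  sumFrom1 m (λ k → term (k * 2) ℤ.+ + v₂ k)  ≡⟨ sumFrom1-cong m term-double ⟩
  sumFrom1 m (λ k → term k ℤ.+ + 1)           ≡⟨ sumFrom1-+ m term (λ _ → + 1) ⟩
  termSum m ℤ.+ sumFrom1 m (λ _ → + 1)        ≡⟨ cong (λ x → termSum m ℤ.+ x) (sumFrom1-one m) ⟩
  termSum m ℤ.+ + m                            ∎

-- n together with g = Σ i·aᵢ and s = Σ aᵢ for some binary digits aᵢ of n.
record Invariant (n g s : ℕ) : Set where
  field
    termSum≡  : termSum n ≡ + g
    legendre  : valSum n ℤ.+ + s ≡ + n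

open Invariant

-- Prepending a digit b: n ↦ b + 2n, Σ i·aᵢ ↦ Σ i·aᵢ + Σ aᵢ, Σ aᵢ ↦ b + Σ aᵢ.
invariant-step : ∀ b m g s → b ≤ 1 → Invariant m g s → Invariant (b ℕ.+ m * 2) (g ℕ.+ s) (b ℕ.+ s)
invariant-step b m g s b≤1 inv = record { termSum≡ = F≡ ; legendre = V≡ }
  where
  V = valSum m

  F-double : termSum (m * 2) ≡ + g ℤ.+ + s
  F-double = ∙-cancelʳ V _ _ (begin
    termSum (m * 2) ℤ.+ V        ≡⟨ termSum-double m ⟩
    termSum m ℤ.+ + m            ≡⟨ cong₂ ℤ._+_ (termSum≡ inv) (sym (legendre inv)) ⟩
    + g ℤ.+ (V ℤ.+ + s)          ≡⟨ regroup (+ g) V (+ s) ⟩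
    + g ℤ.+ + s ℤ.+ V            ∎)
    where
    regroup : ∀ x y z → x ℤ.+ (y ℤ.+ z) ≡ x ℤ.+ z ℤ.+ y
    regroup = solve-∀

  F≡ : termSum (b ℕ.+ m * 2) ≡ + (g ℕ.+ s)
  F≡ = trans (sumFrom1-append-odd b m term b≤1 (term-odd m)) F-double

  V≡ : valSum (b ℕ.+ m * 2) ℤ.+ + (b ℕ.+ s) ≡ + (b ℕ.+ m * 2)
  V≡ = begin
    valSum (b ℕ.+ m * 2) ℤ.+ (+ b ℤ.+ + s)
      ≡⟨ cong (ℤ._+ (+ b ℤ.+ + s)) (sumFrom1-append-odd b m (λ r → + v₂ r) b≤1 (val-odd m)) ⟩
    valSum (m * 2) ℤ.+ (+ b ℤ.+ + s)     ≡⟨ cong (ℤ._+ (+ b ℤ.+ + s)) (valSum-double m) ⟩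
    V ℤ.+ + m ℤ.+ (+ b ℤ.+ + s)          ≡⟨ regroup V (+ m) (+ b) (+ s) ⟩
    + b ℤ.+ (V ℤ.+ + s ℤ.+ + m)          ≡⟨ cong (λ x → + b ℤ.+ (x ℤ.+ + m)) (legendre inv) ⟩
    + b ℤ.+ (+ m ℤ.+ + m)                ≡⟨ cong (λ x → + (b ℕ.+ x)) (twice m) ⟨
    + (b ℕ.+ m * 2)                      ∎
    where
    regroup : ∀ v x y z → v ℤ.+ x ℤ.+ (y ℤ.+ z) ≡ y ℤ.+ (v ℤ.+ z ℤ.+ x)
    regroup = solve-∀
    twice : ∀ k → k * 2 ≡ k ℕ.+ k
    twice = ℕSolver.solve-∀

sumFin-cong : ∀ k {f g : Fin k → ℕ} → (∀ i → f i ≡ g i) → sumFin k f ≡ sumFin k g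
sumFin-cong zero    f≗g = refl
sumFin-cong (suc k) f≗g = cong₂ ℕ._+_ (f≗g Fin.zero) (sumFin-cong k (f≗g ∘ Fin.suc))

sumFin-+ : ∀ k (f g : Fin k → ℕ) → sumFin k (λ i → f i ℕ.+ g i) ≡ sumFin k f ℕ.+ sumFin k g
sumFin-+ zero    f g = refl
sumFin-+ (suc k) f g = begin
  f Fin.zero ℕ.+ g Fin.zero ℕ.+ sumFin k (λ i → f (Fin.suc i) ℕ.+ g (Fin.suc i))
    ≡⟨ cong (f Fin.zero ℕ.+ g Fin.zero ℕ.+_) (sumFin-+ k (f ∘ Fin.suc) (g ∘ Fin.suc)) ⟩
  f Fin.zero ℕ.+ g Fin.zero ℕ.+ (sumFin k (f ∘ Fin.suc) ℕ.+ sumFin k (g ∘ Fin.suc))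
    ≡⟨ ℕ+-interchange (f Fin.zero) (g Fin.zero) _ _ ⟩
  f Fin.zero ℕ.+ sumFin k (f ∘ Fin.suc) ℕ.+ (g Fin.zero ℕ.+ sumFin k (g ∘ Fin.suc)) ∎

sumFin-*ʳ : ∀ k (f : Fin k → ℕ) c → sumFin k (λ i → f i * c) ≡ sumFin k f * c
sumFin-*ʳ zero    f c = refl
sumFin-*ʳ (suc k) f c = trans (cong (f Fin.zero * c ℕ.+_) (sumFin-*ʳ k (f ∘ Fin.suc) c))
                              (sym (ℕP.*-distribʳ-+ c (f Fin.zero) _))

binaryValue : (k : ℕ) → (Fin k → ℕ) → ℕ
binaryValue k a = sumFin k (λ i → a i * 2 ^ toℕ i)

indexWeighted : (k : ℕ) → (Fin k → ℕ) → ℕ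
indexWeighted k a = sumFin k (λ i → toℕ i * a i)

binaryValue-suc : ∀ k (a : Fin (suc k) → ℕ) →
                  binaryValue (suc k) a ≡ a Fin.zero ℕ.+ binaryValue k (a ∘ Fin.suc) * 2
binaryValue-suc k a = cong₂ ℕ._+_ (ℕP.*-identityʳ (a Fin.zero)) (begin
  sumFin k (λ i → a (Fin.suc i) * (2 * 2 ^ toℕ i))  ≡⟨ sumFin-cong k (λ i → shift (a (Fin.suc i)) (2 ^ toℕ i)) ⟩
  sumFin k (λ i → a (Fin.suc i) * 2 ^ toℕ i * 2)    ≡⟨ sumFin-*ʳ k (λ i → a (Fin.suc i) * 2 ^ toℕ i) 2 ⟩
  binaryValue k (a ∘ Fin.suc) * 2                  ∎)
  where
  shift : ∀ x y → x * (2 * y) ≡ x * y * 2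
  shift = ℕSolver.solve-∀

indexWeighted-suc : ∀ k (a : Fin (suc k) → ℕ) →
                    indexWeighted (suc k) a ≡ indexWeighted k (a ∘ Fin.suc) ℕ.+ sumFin k (a ∘ Fin.suc)
indexWeighted-suc k a = trans (sumFin-+ k (a ∘ Fin.suc) (λ i → toℕ i * a (Fin.suc i)))
                              (ℕP.+-comm (sumFin k (a ∘ Fin.suc)) _)

invariant-digits : ∀ k (a : Fin k → ℕ) → (∀ i → a i ≤ 1) →
                   Invariant (binaryValue k a) (indexWeighted k a) (sumFin k a)
invariant-digits zero    a bits = record { termSum≡ = refl ; legendre = refl }
invariant-digits (suc k) a bits =
  subst₂ (λ n g → Invariant n g (sumFin (suc k) a))
         (sym (binaryValue-suc k a)) (sym (indexWeighted-suc k a))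
         (invariant-step (a Fin.zero) _ _ _ (bits Fin.zero)
                         (invariant-digits k (a ∘ Fin.suc) (bits ∘ Fin.suc)))

-- 2^m has the single digit 1 in position m.
invariant-power : ∀ m → Invariant (2 ^ m) m 1
invariant-power zero    = record { termSum≡ = refl ; legendre = refl }
invariant-power (suc m) =
  subst₂ (λ n g → Invariant n g 1) (ℕP.*-comm (2 ^ m) 2) (ℕP.+-comm m 1)
         (invariant-step 0 (2 ^ m) m 1 z≤n (invariant-power m))

theorem5 : ((n : ℕ) → n > 0 → (s : ℕ) → (a : Fin (suc s) → ℕ) →
             (∀ i → a i ≤ 1) →
             n ≡ sumFin (suc s) (λ i → a i * 2 ^ toℕ i) →
             sumFrom1 n term ≡ + sumFin (suc s) (λ i → toℕ i * a i))
           × ((m : ℕ) → sumFrom1 (2 ^ m) term ≡ + m)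
theorem5 = (λ { n _ s a bits refl → termSum≡ (invariant-digits (suc s) a bits) })
         , (λ m → termSum≡ (invariant-power m))
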